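{- Let $m>n$ be positive integers. (1) If $q:=\delta(n)-\delta(m)$ is a rational number, then $q$ is a nonnegative integer, and $m=n\cdot 3^k$ for some integer $k\ge 1$. (2) If $\delta(n)=\delta(m)$, then $m=n\cdot 3^k$ for some integer $k\ge1$, and $\|n\cdot 3^j\|=3j+\|n\|$ for all $0\le j\le k$. In particular, $\delta(n)=\delta(m)$ implies $\|n\|\equiv\|m\|\pmod 3$.
   Context: For a positive integer $n$, its complexity $\|n\|$ is the least number of $1$'s needed to write $n$ using only the constant $1$, addition, multiplication, and parentheses (so $\|1\|=1$ and for $n>1$, $\|n\|=\min\{\|a\|+\|b\|: a,b<n,\ a+b=n \text{ or } ab=n\}$). The defect of $n$ is $\delta(n)=\|n\|-3\log_3 n$. -}

module Defs where

open import Data.Nat using (ℕ; zero; suc; _+_; _*_; _∸_; _^_; _⊓_; _≤?_)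
open import Data.Nat.DivMod using (_/_)
open import Data.Nat.Divisibility using (_∣?_)
open import Data.List using (List; []; _∷_; _++_; upTo; foldr; concatMap; map)
open import Data.Integer using (ℤ; +_; -[1+_])
open import Relation.Nullary using (yes; no)
open import Relation.Binary.PropositionalEquality using (_≡_)

-- Complexity with fuel, following the recursive definition:
--   ‖1‖ = 1,  ‖n‖ = min { ‖a‖+‖b‖ : a,b < n, a+b = n or a*b = n }  (n > 1).
-- With fuel f ≥ n every recursive call is on an argument ≤ fuel, so
-- ‖ n ‖ := cx n n is the genuine complexity for n ≥ 1 (‖0‖ is irrelevant).
cx : ℕ → ℕ → ℕ
cx zero    _ = 0
cx (suc f) n with n ≤? 1
... | yes _ = 1
... | no  _ = foldr _⊓_ (cx f 1 + cx f (n ∸ 1)) (adds ++ mults)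
  where
  -- a = k+1 ranges over 1 .. n-1, b = n - a
  adds : List ℕ
  adds = map (λ k → cx f (suc k) + cx f (n ∸ suc k)) (upTo (n ∸ 1))
  -- a = k+2 ranges over 2 .. n-1 with a ∣ n, b = n / a
  mults : List ℕ
  mults = concatMap (λ k → mul k) (upTo (n ∸ 2))
    where
    mul : ℕ → List ℕ
    mul k with suc (suc k) ∣? n
    ... | yes _ = (cx f (suc (suc k)) + cx f (n / suc (suc k))) ∷ []
    ... | no  _ = []

‖_‖ : ℕ → ℕ
‖ n ‖ = cx n n

-- DefectDiffIs n m a b  means  b · (δ(n) − δ(m)) = a   (for n, m ≥ 1, b ≥ 1),
-- where δ(x) = ‖x‖ − 3 log₃ x.  Exponentiating base 3, this is
--   3^(b‖n‖) · m^(3b) = 3^(a + b‖m‖) · n^(3b),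
-- written with natural-number exponents by moving a negative a to the left.
DefectDiffIs : ℕ → ℕ → ℤ → ℕ → Set
DefectDiffIs n m (+ p)     b = 3 ^ (b * ‖ n ‖) * m ^ (3 * b) ≡ 3 ^ (p + b * ‖ m ‖) * n ^ (3 * b)
DefectDiffIs n m -[1+ p ]  b = 3 ^ (suc p + b * ‖ n ‖) * m ^ (3 * b) ≡ 3 ^ (b * ‖ m ‖) * n ^ (3 * b)

DefectEq : ℕ → ℕ → Set
DefectEq n m = DefectDiffIs n m (+ 0) 1

{-# OPTIONS --safe #-}
module Submission where

-- Exponentiating base 3, b(δ(n) − δ(m)) = a becomes 3^A · m^(3b) = 3^B · n^(3b). Comparing
-- 3-free parts (3 is prime, and x ↦ x^(3b) is injective) gives m = n · 3^k, with k ≥ 1 as m > n.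
-- Since 3 · x is a product, ‖3x‖ ≤ 3 + ‖x‖, hence ‖n · 3^k‖ ≤ 3k + ‖n‖ and
-- δ(n) − δ(m) = 3k + ‖n‖ − ‖m‖ is a natural number, zero exactly when the bound is attained.
-- Attaining it at k forces it at every j ≤ k: 3k + ‖n‖ = ‖n · 3^k‖ ≤ 3(k − j) + ‖n · 3^j‖.

open import Defs
open import Data.Nat
open import Data.Nat.Properties
open import Data.Nat.DivMod using (_/_; _%_; m/n<m; m≥n⇒m/n>0; m*n/n≡m; [m+kn]%n≡m%n)
open import Data.Nat.Divisibility using (_∣_; _∣?_; divides; m∣m*n; ∣1⇒≡1)
open import Data.Nat.Primality using (Prime; prime?; euclidsLemma; prime⇒nonZero; prime⇒nonTrivial)
open import Data.Nat.Induction using (<-wellFounded)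
open import Data.Nat.Tactic.RingSolver using (solve-∀)
open import Data.Integer using (ℤ; +_; -[1+_])
open import Data.List using (List; []; _∷_; _++_; foldr; map; concat; concatMap; upTo)
open import Data.List.Properties using (map-cong-local; concatMap-cong)
open import Data.List.Relation.Unary.All as All using ()
open import Data.List.Relation.Unary.All.Properties using (all-upTo)
open import Data.List.Relation.Unary.Any using (here; there)
open import Data.List.Membership.Propositional using (_∈_)
open import Data.List.Membership.Propositional.Properties using (∈-++⁺ʳ; ∈-concat⁺′; ∈-map⁺; ∈-upTo⁺)
open import Data.Product using (_×_; _,_; proj₂; ∃-syntax; ∃₂)
open import Data.Sum using ([_,_]′)
open import Induction.WellFounded using (Acc; acc)
open import Relation.Nullary using (¬_; yes; no; contradiction)
open import Relation.Nullary.Decidable using (from-yes)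
open import Relation.Binary.Definitions using (tri<; tri≈; tri>)
open import Relation.Binary.PropositionalEquality
open import Algebra.Properties.CommutativeSemigroup *-commutativeSemigroup using ()
  renaming (x∙yz≈y∙xz to m*[n*o]≡n*[m*o]; xy∙z≈xz∙y to m*n*o≡m*o*n)

productsAt : (ℕ → ℕ) → ℕ → ℕ → List ℕ
productsAt c n k with suc (suc k) ∣? n
... | yes _ = c (suc (suc k)) + c (n / suc (suc k)) ∷ []
... | no  _ = []

sums products : (ℕ → ℕ) → ℕ → List ℕ
sums     c n = map (λ k → c (suc k) + c (n ∸ suc k)) (upTo (n ∸ 1))
products c n = concatMap (productsAt c n) (upTo (n ∸ 2))

cxStep : (ℕ → ℕ) → ℕ → ℕ
cxStep c n = foldr _⊓_ (c 1 + c (n ∸ 1)) (sums c n ++ products c n)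

mutual
  cx-suc : ∀ f n → ¬ n ≤ 1 → cx (suc f) n ≡ cxStep (cx f) n
  cx-suc f n n≰1 with n ≤? 1
  ... | yes n≤1 = contradiction n≤1 n≰1
  ... | no n≰1′ = cong (λ ps → foldr _⊓_ (cx f 1 + cx f (n ∸ 1)) (sums (cx f) n ++ ps))
                       (concatMap-cong (productsAt-unfolds f n n≰1′) (upTo (n ∸ 2)))

  -- The type, `mul k ≡ productsAt (cx f) n k` for the local function `mul` of `cx`,
  -- cannot be written since `mul` is out of scope; Agda infers it from the use in `cx-suc`.
  productsAt-unfolds : ∀ f n (n≰1 : ¬ n ≤ 1) (k : ℕ) → _
  productsAt-unfolds f n _ k with suc (suc k) ∣? n
  ... | yes _ = refl
  ... | no  _ = refl

AgreeBelow : ℕ → (ℕ → ℕ) → (ℕ → ℕ) → Set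
AgreeBelow n c d = ∀ {m} → 1 ≤ m → m < n → c m ≡ d m

productsAt-cong : ∀ {c d} n′ {k} → AgreeBelow (2 + n′) c d → k < n′ →
                  productsAt c (2 + n′) k ≡ productsAt d (2 + n′) k
productsAt-cong n′ {k} c≐d k<n′ with 2 + k ∣? 2 + n′
... | no  _ = refl
... | yes _ = cong (λ x → x ∷ [])
  (cong₂ _+_ (c≐d (s≤s z≤n) (s≤s (s≤s k<n′)))
             (c≐d (m≥n⇒m/n>0 (s≤s (s≤s (<⇒≤ k<n′)))) (m/n<m (2 + n′) (2 + k) (s≤s (s≤s z≤n)))))

cxStep-cong : ∀ {c d} n′ → AgreeBelow (2 + n′) c d → cxStep c (2 + n′) ≡ cxStep d (2 + n′)
cxStep-cong {c} {d} n′ c≐d =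
  cong₂ (foldr _⊓_) (cong₂ _+_ (c≐d ≤-refl (s≤s (s≤s z≤n))) (c≐d (s≤s z≤n) ≤-refl))
    (cong₂ _++_ (map-cong-local (All.map sum-cong (all-upTo (suc n′))))
                (cong concat (map-cong-local (All.map (productsAt-cong n′ c≐d) (all-upTo n′)))))
  where
  sum-cong : ∀ {k} → k < suc n′ → c (suc k) + c (2 + n′ ∸ suc k) ≡ d (suc k) + d (2 + n′ ∸ suc k)
  sum-cong {k} k<1+n′ =
    cong₂ _+_ (c≐d (s≤s z≤n) (s≤s k<1+n′)) (c≐d (m<n⇒0<n∸m k<1+n′) (s≤s (m∸n≤m (suc n′) k)))

cx-fuel-suc : ∀ f n → 1 ≤ n → n ≤ f → cx (suc f) n ≡ cx f n
cx-fuel-suc (suc f) 1 _ _ = refl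
cx-fuel-suc (suc f) (2+ n′) _ n≤1+f = begin
  cx (2 + f) (2 + n′)            ≡⟨ cx-suc (suc f) (2 + n′) (λ { (s≤s ()) }) ⟩
  cxStep (cx (suc f)) (2 + n′)   ≡⟨ cxStep-cong n′ (λ 1≤m m<n →
                                      cx-fuel-suc f _ 1≤m (≤-trans (s≤s⁻¹ m<n) (s≤s⁻¹ n≤1+f))) ⟩
  cxStep (cx f) (2 + n′)         ≡⟨ cx-suc f (2 + n′) (λ { (s≤s ()) }) ⟨
  cx (suc f) (2 + n′)            ∎
  where open ≡-Reasoning

cx-fuel : ∀ f n → 1 ≤ n → n ≤ f → cx f n ≡ ‖ n ‖
cx-fuel f n 1≤n n≤f = go (≤⇒≤′ n≤f)
  where
  go : ∀ {f} → n ≤′ f → cx f n ≡ ‖ n ‖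
  go ≤′-refl          = refl
  go (≤′-step n≤′f) = trans (cx-fuel-suc _ n 1≤n (≤′⇒≤ n≤′f)) (go n≤′f)

foldr-⊓-≤ : ∀ {x} d xs → x ∈ xs → foldr _⊓_ d xs ≤ x
foldr-⊓-≤ d (y ∷ xs) (here refl) = m⊓n≤m y _
foldr-⊓-≤ d (y ∷ xs) (there x∈xs) = ≤-trans (m⊓n≤n y _) (foldr-⊓-≤ d xs x∈xs)

productsAt-∋ : ∀ c n k → 2 + k ∣ n → c (2 + k) + c (n / (2 + k)) ∈ productsAt c n k
productsAt-∋ c n k a∣n with 2 + k ∣? n
... | yes _   = here refl
... | no  a∤n = contradiction a∣n a∤n

cxStep-≤-product : ∀ c a b → 2 ≤ a → 2 ≤ b → cxStep c (a * b) ≤ c a + c b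
cxStep-≤-product c a b (s≤s (s≤s (z≤n {k}))) 1<b =
  subst (λ q → cxStep c (a * b) ≤ c a + c q) (trans (cong (_/ a) (*-comm a b)) (m*n/n≡m b a))
    (foldr-⊓-≤ _ _ (∈-++⁺ʳ (sums c (a * b))
      (∈-concat⁺′ (productsAt-∋ c (a * b) k (divides b (*-comm a b)))
                  (∈-map⁺ (productsAt c (a * b)) (∈-upTo⁺ (∸-monoˡ-< (m<m*n a b 1<b) (m≤m+n 2 k)))))))

‖*‖≤‖‖+‖‖ : ∀ a b → 2 ≤ a → 2 ≤ b → ‖ a * b ‖ ≤ ‖ a ‖ + ‖ b ‖
‖*‖≤‖‖+‖‖ a b 2≤a@(s≤s (s≤s _)) 2≤b@(s≤s (s≤s _)) = begin
  ‖ a * b ‖                 ≡⟨ cx-suc F (a * b) (λ { (s≤s ()) }) ⟩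
  cxStep (cx F) (a * b)     ≤⟨ cxStep-≤-product (cx F) a b 2≤a 2≤b ⟩
  cx F a + cx F b           ≡⟨ cong₂ _+_ (cx-fuel F a (s≤s z≤n) a≤F) (cx-fuel F b (s≤s z≤n) b≤F) ⟩
  ‖ a ‖ + ‖ b ‖             ∎
  where
  open ≤-Reasoning
  F = pred (a * b)
  a≤F : a ≤ F
  a≤F = s≤s⁻¹ (m<m*n a b 2≤b)
  b≤F : b ≤ F
  b≤F = s≤s⁻¹ (subst (b <_) (*-comm b a) (m<m*n b a 2≤a))

‖3*‖≤3+‖‖ : ∀ x → 1 ≤ x → ‖ 3 * x ‖ ≤ 3 + ‖ x ‖
‖3*‖≤3+‖‖ 1        _ = m≤m+n 3 1
‖3*‖≤3+‖‖ x@(2+ _) _ = ‖*‖≤‖‖+‖‖ 3 x (s≤s (s≤s z≤n)) (s≤s (s≤s z≤n))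

‖*3^‖≤3*+‖‖ : ∀ x i → 1 ≤ x → ‖ x * 3 ^ i ‖ ≤ 3 * i + ‖ x ‖
‖*3^‖≤3*+‖‖ x zero    _   = ≤-reflexive (cong ‖_‖ (*-identityʳ x))
‖*3^‖≤3*+‖‖ x (suc i) 1≤x = begin
  ‖ x * (3 * 3 ^ i) ‖     ≡⟨ cong ‖_‖ (m*[n*o]≡n*[m*o] x 3 (3 ^ i)) ⟩
  ‖ 3 * (x * 3 ^ i) ‖     ≤⟨ ‖3*‖≤3+‖‖ (x * 3 ^ i) (*-mono-≤ 1≤x (m^n>0 3 i)) ⟩
  3 + ‖ x * 3 ^ i ‖       ≤⟨ +-monoʳ-≤ 3 (‖*3^‖≤3*+‖‖ x i 1≤x) ⟩
  3 + (3 * i + ‖ x ‖)     ≡⟨ +-assoc 3 (3 * i) ‖ x ‖ ⟨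
  3 + 3 * i + ‖ x ‖       ≡⟨ cong (_+ ‖ x ‖) (*-suc 3 i) ⟨
  3 * suc i + ‖ x ‖       ∎
  where open ≤-Reasoning

^-distrib-* : ∀ a c e → (a * c) ^ e ≡ a ^ e * c ^ e
^-distrib-* a c zero    = refl
^-distrib-* a c (suc e) = trans (cong (a * c *_) (^-distrib-* a c e)) ([m*n]*[o*p]≡[m*o]*[n*p] a c (a ^ e) (c ^ e))

^-cancelʳ-≡ : ∀ {a c} e .{{_ : NonZero e}} → a ^ e ≡ c ^ e → a ≡ c
^-cancelʳ-≡ {a} {c} e aᵉ≡cᵉ with <-cmp a c
... | tri< a<c _ _ = contradiction aᵉ≡cᵉ (<⇒≢ (^-monoˡ-< e a<c))
... | tri≈ _ a≡c _ = a≡c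
... | tri> _ _ c<a = contradiction (sym aᵉ≡cᵉ) (<⇒≢ (^-monoˡ-< e c<a))

^-cancelˡ-≡ : ∀ p {a b} → 1 < p → p ^ a ≡ p ^ b → a ≡ b
^-cancelˡ-≡ p {a} {b} 1<p pᵃ≡pᵇ with <-cmp a b
... | tri< a<b _ _ = contradiction pᵃ≡pᵇ (<⇒≢ (^-monoʳ-< p 1<p a<b))
... | tri≈ _ a≡b _ = a≡b
... | tri> _ _ b<a = contradiction (sym pᵃ≡pᵇ) (<⇒≢ (^-monoʳ-< p 1<p b<a))

module _ {p : ℕ} .{{_ : NonZero p}} where

  p^a*[p^v*c]^e≡p^[a+v*e]*c^e : ∀ a v c e → p ^ a * (p ^ v * c) ^ e ≡ p ^ (a + v * e) * c ^ e
  p^a*[p^v*c]^e≡p^[a+v*e]*c^e a v c e = begin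
    p ^ a * (p ^ v * c) ^ e          ≡⟨ cong (p ^ a *_) (^-distrib-* (p ^ v) c e) ⟩
    p ^ a * ((p ^ v) ^ e * c ^ e)    ≡⟨ cong (λ q → p ^ a * (q * c ^ e)) (^-*-assoc p v e) ⟩
    p ^ a * (p ^ (v * e) * c ^ e)    ≡⟨ *-assoc (p ^ a) _ _ ⟨
    p ^ a * p ^ (v * e) * c ^ e      ≡⟨ cong (_* c ^ e) (^-distribˡ-+-* p a (v * e)) ⟨
    p ^ (a + v * e) * c ^ e          ∎
    where open ≡-Reasoning

  same-cofactor⇒≡*^ : ∀ {m n u v c} → n < m → m ≡ p ^ v * c → n ≡ p ^ u * c →
                      ∃[ k ] (1 ≤ k × m ≡ n * p ^ k)
  same-cofactor⇒≡*^ {u = u} {v} {c} n<m refl refl with v ≤? u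
  ... | yes v≤u = contradiction (*-monoˡ-≤ c (^-monoʳ-≤ p v≤u)) (<⇒≱ n<m)
  ... | no  v≰u = v ∸ u , m<n⇒0<n∸m (≰⇒> v≰u) , (begin
    p ^ v * c                  ≡⟨ cong (λ w → p ^ w * c) (m+[n∸m]≡n (<⇒≤ (≰⇒> v≰u))) ⟨
    p ^ (u + (v ∸ u)) * c      ≡⟨ cong (_* c) (^-distribˡ-+-* p u (v ∸ u)) ⟩
    p ^ u * p ^ (v ∸ u) * c    ≡⟨ m*n*o≡m*o*n (p ^ u) (p ^ (v ∸ u)) c ⟩
    p ^ u * c * p ^ (v ∸ u)    ∎)
    where open ≡-Reasoning

module _ {p : ℕ} (prime-p : Prime p) where

  private instance
    p≢0 = prime⇒nonZero prime-p
    p>1 = prime⇒nonTrivial prime-p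

  ∤⇒∤^ : ∀ {a} e → ¬ p ∣ a → ¬ p ∣ a ^ e
  ∤⇒∤^ zero    _   p∣1    = nonTrivial⇒≢1 (∣1⇒≡1 p∣1)
  ∤⇒∤^ (suc e) p∤a p∣aᵉ⁺¹ = [ p∤a , ∤⇒∤^ e p∤a ]′ (euclidsLemma _ _ prime-p p∣aᵉ⁺¹)

  p-adic-split : ∀ x → 1 ≤ x → ∃₂ λ u c → x ≡ p ^ u * c × ¬ p ∣ c
  p-adic-split x = split x (<-wellFounded x)
    where
    split : ∀ x → Acc _<_ x → 1 ≤ x → ∃₂ λ u c → x ≡ p ^ u * c × ¬ p ∣ c
    split x _ _ with p ∣? x
    split x _         _   | no  p∤x = 0 , x , sym (+-identityʳ x) , p∤x
    split _ _         ()  | yes (divides zero refl)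
    split _ (acc rec) _   | yes (divides q@(suc _) refl)
      with split q (rec (m<m*n q p (nonTrivial⇒n>1 p))) (s≤s z≤n)
    ... | u , c , q≡p^u*c , p∤c =
      suc u , c , trans (*-comm q p) (trans (cong (p *_) q≡p^u*c) (sym (*-assoc p _ c))) , p∤c

  p^u*a≡p^v*c⇒ : ∀ u v {a c} → ¬ p ∣ a → ¬ p ∣ c → p ^ u * a ≡ p ^ v * c → u ≡ v × a ≡ c
  p^u*a≡p^v*c⇒ zero    zero    _   _   eq = refl , trans (sym (*-identityˡ _)) (trans eq (*-identityˡ _))
  p^u*a≡p^v*c⇒ (suc u) zero    _   p∤c eq =
    contradiction (subst (p ∣_) (trans (sym (*-assoc p _ _)) (trans eq (*-identityˡ _))) (m∣m*n _)) p∤c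
  p^u*a≡p^v*c⇒ zero    (suc v) p∤a _   eq =
    contradiction (subst (p ∣_) (trans (sym (*-assoc p _ _)) (trans (sym eq) (*-identityˡ _))) (m∣m*n _)) p∤a
  p^u*a≡p^v*c⇒ (suc u) (suc v) p∤a p∤c eq
    with p^u*a≡p^v*c⇒ u v p∤a p∤c (*-cancelˡ-≡ _ _ p (trans (sym (*-assoc p _ _)) (trans eq (*-assoc p _ _))))
  ... | refl , a≡c = refl , a≡c

  p^a*m^e≡p^b*n^e⇒m≡n*p^k : ∀ {a b m n} e .{{_ : NonZero e}} → 1 ≤ n → n < m →
                            p ^ a * m ^ e ≡ p ^ b * n ^ e → ∃[ k ] (1 ≤ k × m ≡ n * p ^ k)
  p^a*m^e≡p^b*n^e⇒m≡n*p^k {a} {b} {m} {n} e 1≤n n<m eq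
    with p-adic-split m (≤-trans 1≤n (<⇒≤ n<m)) | p-adic-split n 1≤n
  ... | v , c , m≡p^v*c , p∤c | u , d , n≡p^u*d , p∤d =
    same-cofactor⇒≡*^ {u = u} {v = v} n<m m≡p^v*c (trans n≡p^u*d (cong (p ^ u *_) (sym c≡d)))
    where
    c≡d : c ≡ d
    c≡d = ^-cancelʳ-≡ e (proj₂ (p^u*a≡p^v*c⇒ (a + v * e) (b + u * e) (∤⇒∤^ e p∤c) (∤⇒∤^ e p∤d) (begin
      p ^ (a + v * e) * c ^ e    ≡⟨ p^a*[p^v*c]^e≡p^[a+v*e]*c^e a v c e ⟨
      p ^ a * (p ^ v * c) ^ e    ≡⟨ cong (λ x → p ^ a * x ^ e) m≡p^v*c ⟨
      p ^ a * m ^ e              ≡⟨ eq ⟩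
      p ^ b * n ^ e              ≡⟨ cong (λ x → p ^ b * x ^ e) n≡p^u*d ⟩
      p ^ b * (p ^ u * d) ^ e    ≡⟨ p^a*[p^v*c]^e≡p^[a+v*e]*c^e b u d e ⟩
      p ^ (b + u * e) * d ^ e    ∎)))
      where open ≡-Reasoning

prime-3 : Prime 3
prime-3 = from-yes (prime? 3)

3^c*[n*3^k]^3≡3^[3k+c]*n^3 : ∀ n k c → 3 ^ c * (n * 3 ^ k) ^ 3 ≡ 3 ^ (3 * k + c) * n ^ 3
3^c*[n*3^k]^3≡3^[3k+c]*n^3 n k c = begin
  3 ^ c * (n * 3 ^ k) ^ 3    ≡⟨ cong (λ x → 3 ^ c * x ^ 3) (*-comm n (3 ^ k)) ⟩
  3 ^ c * (3 ^ k * n) ^ 3    ≡⟨ p^a*[p^v*c]^e≡p^[a+v*e]*c^e c k n 3 ⟩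
  3 ^ (c + k * 3) * n ^ 3    ≡⟨ cong (λ w → 3 ^ w * n ^ 3) (trans (+-comm c (k * 3)) (cong (_+ c) (*-comm k 3))) ⟩
  3 ^ (3 * k + c) * n ^ 3    ∎
  where open ≡-Reasoning

defectDiffIs-*3^ : ∀ {n} k → 1 ≤ n → DefectDiffIs n (n * 3 ^ k) (+ (3 * k + ‖ n ‖ ∸ ‖ n * 3 ^ k ‖)) 1
defectDiffIs-*3^ {n} k 1≤n = begin
  3 ^ (1 * ‖ n ‖) * (n * 3 ^ k) ^ 3      ≡⟨ cong (λ w → 3 ^ w * (n * 3 ^ k) ^ 3) (*-identityˡ ‖ n ‖) ⟩
  3 ^ ‖ n ‖ * (n * 3 ^ k) ^ 3            ≡⟨ 3^c*[n*3^k]^3≡3^[3k+c]*n^3 n k ‖ n ‖ ⟩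
  3 ^ (3 * k + ‖ n ‖) * n ^ 3            ≡⟨ cong (λ w → 3 ^ w * n ^ 3) (m∸n+n≡m (‖*3^‖≤3*+‖‖ n k 1≤n)) ⟨
  3 ^ (t + M) * n ^ 3                    ≡⟨ cong (λ w → 3 ^ (t + w) * n ^ 3) (*-identityˡ M) ⟨
  3 ^ (t + 1 * M) * n ^ 3                ∎
  where
  open ≡-Reasoning
  M = ‖ n * 3 ^ k ‖
  t = 3 * k + ‖ n ‖ ∸ M

defectEq-*3^⇒‖*3^‖≡ : ∀ {n} k → 1 ≤ n → DefectEq n (n * 3 ^ k) → ‖ n * 3 ^ k ‖ ≡ 3 * k + ‖ n ‖
defectEq-*3^⇒‖*3^‖≡ {n} k 1≤n D = sym (^-cancelˡ-≡ 3 (s≤s (s≤s z≤n)) (*-cancelʳ-≡ _ _ (n ^ 3) (begin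
  3 ^ (3 * k + ‖ n ‖) * n ^ 3            ≡⟨ 3^c*[n*3^k]^3≡3^[3k+c]*n^3 n k ‖ n ‖ ⟨
  3 ^ ‖ n ‖ * (n * 3 ^ k) ^ 3            ≡⟨ cong (λ w → 3 ^ w * (n * 3 ^ k) ^ 3) (*-identityˡ ‖ n ‖) ⟨
  3 ^ (1 * ‖ n ‖) * (n * 3 ^ k) ^ 3      ≡⟨ D ⟩
  3 ^ (1 * M) * n ^ 3                    ≡⟨ cong (λ w → 3 ^ w * n ^ 3) (*-identityˡ M) ⟩
  3 ^ M * n ^ 3                          ∎)))
  where
  open ≡-Reasoning
  M = ‖ n * 3 ^ k ‖
  instance _ = m^n≢0 n 3 {{>-nonZero 1≤n}}

3*b-nonZero : ∀ {b} → 1 ≤ b → NonZero (3 * b)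
3*b-nonZero {b} 1≤b = >-nonZero (≤-trans 1≤b (m≤n*m b 3))

defectDiffIs⇒≡*3^ : ∀ {n m} a b → 1 ≤ n → n < m → 1 ≤ b → DefectDiffIs n m a b →
                    ∃[ k ] (1 ≤ k × m ≡ n * 3 ^ k)
defectDiffIs⇒≡*3^ {n} {m} (+ t)     b 1≤n n<m 1≤b D =
  p^a*m^e≡p^b*n^e⇒m≡n*p^k prime-3 {a = b * ‖ n ‖} {b = t + b * ‖ m ‖} (3 * b) {{3*b-nonZero 1≤b}} 1≤n n<m D
defectDiffIs⇒≡*3^ {n} {m} -[1+ t ] b 1≤n n<m 1≤b D =
  p^a*m^e≡p^b*n^e⇒m≡n*p^k prime-3 {a = suc t + b * ‖ n ‖} {b = b * ‖ m ‖} (3 * b) {{3*b-nonZero 1≤b}} 1≤n n<m D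

‖*3^[j+d]‖≡⇒‖*3^j‖≡ : ∀ {n} j d → 1 ≤ n → ‖ n * 3 ^ (j + d) ‖ ≡ 3 * (j + d) + ‖ n ‖ →
                       ‖ n * 3 ^ j ‖ ≡ 3 * j + ‖ n ‖
‖*3^[j+d]‖≡⇒‖*3^j‖≡ {n} j d 1≤n tight = ≤-antisym (‖*3^‖≤3*+‖‖ n j 1≤n) (+-cancelˡ-≤ (3 * d) _ _ (begin
  3 * d + (3 * j + ‖ n ‖)    ≡⟨ reassoc d j ‖ n ‖ ⟩
  3 * (j + d) + ‖ n ‖        ≡⟨ tight ⟨
  ‖ n * 3 ^ (j + d) ‖        ≡⟨ cong ‖_‖ (trans (cong (n *_) (^-distribˡ-+-* 3 j d)) (sym (*-assoc n _ _))) ⟩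
  ‖ n * 3 ^ j * 3 ^ d ‖      ≤⟨ ‖*3^‖≤3*+‖‖ (n * 3 ^ j) d (*-mono-≤ 1≤n (m^n>0 3 j)) ⟩
  3 * d + ‖ n * 3 ^ j ‖      ∎))
  where
  open ≤-Reasoning
  reassoc : ∀ d j x → 3 * d + (3 * j + x) ≡ 3 * (j + d) + x
  reassoc = solve-∀

defectEq⇒≡*3^ : ∀ {n m} → 1 ≤ n → n < m → DefectEq n m →
                ∃[ k ] (1 ≤ k × m ≡ n * 3 ^ k × ‖ m ‖ ≡ 3 * k + ‖ n ‖)
defectEq⇒≡*3^ 1≤n n<m D with defectDiffIs⇒≡*3^ (+ 0) 1 1≤n n<m ≤-refl D
... | k , 1≤k , refl = k , 1≤k , refl , defectEq-*3^⇒‖*3^‖≡ k 1≤n D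

proposition2p6 : (n m : ℕ) → 1 ≤ n → n < m →
  (((a : ℤ) (b : ℕ) → 1 ≤ b → DefectDiffIs n m a b →
      (∃[ t ] DefectDiffIs n m (+ t) 1) × (∃[ k ] (1 ≤ k × m ≡ n * 3 ^ k)))
  × (DefectEq n m →
      ∃[ k ] (1 ≤ k × m ≡ n * 3 ^ k × ((j : ℕ) → j ≤ k → ‖ n * 3 ^ j ‖ ≡ 3 * j + ‖ n ‖)))
  × (DefectEq n m → ‖ n ‖ % 3 ≡ ‖ m ‖ % 3))
proposition2p6 n m 1≤n n<m = integral-difference , tight-along-powers , same-residue
  where
  integral-difference : (a : ℤ) (b : ℕ) → 1 ≤ b → DefectDiffIs n m a b →
                        (∃[ t ] DefectDiffIs n m (+ t) 1) × (∃[ k ] (1 ≤ k × m ≡ n * 3 ^ k))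
  integral-difference a b 1≤b D with k , 1≤k , m≡n*3ᵏ ← defectDiffIs⇒≡*3^ a b 1≤n n<m 1≤b D =
    (t , subst (λ x → DefectDiffIs n x (+ t) 1) (sym m≡n*3ᵏ) (defectDiffIs-*3^ k 1≤n)) , k , 1≤k , m≡n*3ᵏ
    where t = 3 * k + ‖ n ‖ ∸ ‖ n * 3 ^ k ‖

  tight-along-powers : DefectEq n m →
    ∃[ k ] (1 ≤ k × m ≡ n * 3 ^ k × ((j : ℕ) → j ≤ k → ‖ n * 3 ^ j ‖ ≡ 3 * j + ‖ n ‖))
  tight-along-powers D with k , 1≤k , m≡n*3ᵏ , ‖m‖≡ ← defectEq⇒≡*3^ 1≤n n<m D =
    k , 1≤k , m≡n*3ᵏ , λ j j≤k → ‖*3^[j+d]‖≡⇒‖*3^j‖≡ j (k ∸ j) 1≤n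
      (subst (λ i → ‖ n * 3 ^ i ‖ ≡ 3 * i + ‖ n ‖) (sym (m+[n∸m]≡n j≤k)) (trans (cong ‖_‖ (sym m≡n*3ᵏ)) ‖m‖≡))

  same-residue : DefectEq n m → ‖ n ‖ % 3 ≡ ‖ m ‖ % 3
  same-residue D with k , _ , _ , ‖m‖≡ ← defectEq⇒≡*3^ 1≤n n<m D =
    trans (sym ([m+kn]%n≡m%n ‖ n ‖ k 3))
          (cong (_% 3) (sym (trans ‖m‖≡ (trans (+-comm (3 * k) _) (cong (_+_ ‖ n ‖) (*-comm 3 k))))))
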